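{- Let $t$ be a non-negative integer and $n$ a positive integer. Let $M(z)$ be the formal power series satisfying $M(z)=1+2zM(z)+z^2M(z)^2$. Then $$\langle z^n\rangle\frac {\left(zM(z)\right)^{t+2}}{(1+zM(z))^2}=\binom {2n-3}{n-t-2}-\binom {2n-3}{n-t-3}.$$
   Context: $M(z)$ is the unique formal power series in $z$ with integer coefficients satisfying the stated equation (this is the specialisation $x=y=\alpha=1$ of the series defined by $M=1+(x+y)zM+\alpha z^2M^2$). $\langle z^n\rangle F(z)$ denotes the coefficient of $z^n$ in $F(z)$. Binomial convention: $\binom{a}{k}=a(a-1)\cdots(a-k+1)/k!$ for integers $k\ge0$ and $\binom ak=0$ for $k<0$. -}

module Defs where

open import Data.Nat as ℕ using (ℕ; zero; suc; _!)
open import Data.Nat.Properties using (_!≢0)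
open import Data.Integer using (ℤ; +_; -[1+_]; _+_; _*_; _-_; -_; 0ℤ; 1ℤ)
open import Data.Integer.Base using (_/ℕ_)
open import Data.List using (List; upTo; map)
open import Data.Integer.Base using () renaming (_+_ to _+ℤ_)

PS : Set
PS = ℕ → ℤ

Σ≤ : ℕ → (ℕ → ℤ) → ℤ
Σ≤ zero    f = f zero
Σ≤ (suc n) f = Σ≤ n f + f (suc n)

coeff : ℕ → PS → ℤ
coeff n F = F n

const : ℤ → PS
const c zero    = c
const c (suc n) = 0ℤ

oneₚ : PS
oneₚ = const 1ℤ

zₚ : PS
zₚ zero          = 0ℤ
zₚ (suc zero)    = 1ℤ
zₚ (suc (suc n)) = 0ℤ

infixl 6 _+ₚ_ _-ₚ_
infixl 7 _*ₚ_
infixr 8 _^ₚ_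

_+ₚ_ : PS → PS → PS
(F +ₚ G) n = F n + G n

_-ₚ_ : PS → PS → PS
(F -ₚ G) n = F n - G n

_*ₚ_ : PS → PS → PS
(F *ₚ G) n = Σ≤ n (λ i → F i * G (n ℕ.∸ i))

_^ₚ_ : PS → ℕ → PS
F ^ₚ zero  = oneₚ
F ^ₚ suc k = F *ₚ F ^ₚ k

-- Multiplicative inverse of a series A with constant term 1:
-- A⁻¹ = Σ_{k≥0} (1 - A)^k; since (1 - A) has zero constant term,
-- (1 - A)^k contributes to ⟨zⁿ⟩ only for k ≤ n.
inv : PS → PS
inv A n = Σ≤ n (λ k → ((oneₚ -ₚ A) ^ₚ k) n)

falling : ℤ → ℕ → ℤ
falling a zero    = 1ℤ
falling a (suc k) = falling a k * (a - + k)

binom : ℤ → ℤ → ℤ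
binom a (+ k)      = (falling a k /ℕ (k !)) {{k !≢0}}
binom a -[1+ k ]   = 0ℤ

-- Completing the square, the equation for M says M = C² with C = 1 + zM, so C = 1 + zC² is the
-- Catalan series and (zM)^(t+2) / (1 + zM)² = z^(t+2) C^(2t+2). Writing C^(k+1) = C^k + z C^(k+2)
-- shows that the coefficients ⟨z^m⟩ C^k satisfy the ballot recurrence, whose solution (by Pascal's
-- rule) is binom(2m+k-1, m) - binom(2m+k-1, m-1).
module Submission where

open import Defs
open import Data.Nat using (ℕ; _≤_)
open import Data.Integer using (ℤ; +_; _-_)
open import Relation.Binary.PropositionalEquality using (_≡_)
open import Algebra.Bundles using (CommutativeSemiring)

module CommutativeSemiringLemmas {c ℓ} (R : CommutativeSemiring c ℓ) where
  open CommutativeSemiring R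
  open import Algebra.Properties.CommutativeSemiring.Exp R using (_^_; ^-distrib-*; ^-homo-*)
  open import Data.Nat using (suc) renaming (_+_ to _+ℕ_)
  open import Relation.Binary.Reasoning.Setoid setoid

  x*w≈1⇒x^[1+j]*w≈x^j : ∀ {x w} j → x * w ≈ 1# → x ^ suc j * w ≈ x ^ j
  x*w≈1⇒x^[1+j]*w≈x^j {x} {w} j x*w≈1 = begin
    x * x ^ j * w   ≈⟨ *-congʳ (*-comm x (x ^ j)) ⟩
    x ^ j * x * w   ≈⟨ *-assoc (x ^ j) x w ⟩
    x ^ j * (x * w) ≈⟨ *-congˡ x*w≈1 ⟩
    x ^ j * 1#      ≈⟨ *-identityʳ (x ^ j) ⟩
    x ^ j           ∎

  m*w≈1⇒[z*m]^[1+j]*w≈z^[1+j]*m^j : ∀ {m w} z j → m * w ≈ 1# → (z * m) ^ suc j * w ≈ z ^ suc j * m ^ j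
  m*w≈1⇒[z*m]^[1+j]*w≈z^[1+j]*m^j {m} {w} z j m*w≈1 = begin
    (z * m) ^ suc j * w           ≈⟨ *-congʳ (^-distrib-* z m (suc j)) ⟩
    z ^ suc j * m ^ suc j * w     ≈⟨ *-assoc (z ^ suc j) (m ^ suc j) w ⟩
    z ^ suc j * (m ^ suc j * w)   ≈⟨ *-congˡ (x*w≈1⇒x^[1+j]*w≈x^j j m*w≈1) ⟩
    z ^ suc j * m ^ j             ∎

  c≈1+zc²⇒c^[1+k]≈c^k+z*c^[2+k] : ∀ {c z} k → c ≈ 1# + z * c ^ 2 → c ^ suc k ≈ c ^ k + z * c ^ (2 +ℕ k)
  c≈1+zc²⇒c^[1+k]≈c^k+z*c^[2+k] {c} {z} k c≈1+zc² = begin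
    c * c ^ k                       ≈⟨ *-congʳ c≈1+zc² ⟩
    (1# + z * c ^ 2) * c ^ k        ≈⟨ distribʳ (c ^ k) 1# (z * c ^ 2) ⟩
    1# * c ^ k + z * c ^ 2 * c ^ k  ≈⟨ +-cong (*-identityˡ (c ^ k)) (*-assoc z (c ^ 2) (c ^ k)) ⟩
    c ^ k + z * (c ^ 2 * c ^ k)     ≈⟨ +-congˡ (*-congˡ (^-homo-* c 2 k)) ⟨
    c ^ k + z * c ^ (2 +ℕ k)        ∎

open import Algebra.Structures.Biased using (isCommutativeSemiringˡ; isCommutativeMonoidˡ)
import Algebra.Construct.Pointwise as Pointwise
import Algebra.Solver.Ring.NaturalCoefficients.Default as SemiringSolver
import Data.Integer.Properties as ℤP
open import Algebra.Properties.CommutativeSemigroup ℤP.+-commutativeSemigroup using (interchange)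
open import Data.Nat as ℕ using (zero; suc; _<_; _∸_; _!; z≤n; s≤s)
import Data.Nat.Properties as ℕP
open import Data.Nat.Properties using (_!≢0)
open import Data.Nat.Combinatorics using (_C_; _P_; nCk+nC[k+1]≡[n+1]C[k+1]; nCk≡nC[n∸k]; nCk≡nPk/k!)
open import Data.Nat.Combinatorics.Base using (_P′_)
open import Data.Nat.Combinatorics.Specification using (nPk≡n!/[n∸k]!; nP′k≡n!/[n∸k]!)
import Data.Nat.Tactic.RingSolver as ℕSolver
open import Data.Integer using (_+_; _*_; -_; 0ℤ; 1ℤ; _/ℕ_; _⊖_)
open import Data.Integer.Tactic.RingSolver using (solve-∀)
open import Data.Product using (_,_)
open import Data.Sum using (inj₁; inj₂)
open import Function.Base using (_∘_)
open import Level using (0ℓ)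
open import Relation.Binary.PropositionalEquality
import Relation.Binary.Reasoning.Setoid as SetoidReasoning

Σ≤-cong : ∀ n {f g : ℕ → ℤ} → (∀ {i} → i ≤ n → f i ≡ g i) → Σ≤ n f ≡ Σ≤ n g
Σ≤-cong zero    f≗g = f≗g z≤n
Σ≤-cong (suc n) f≗g = cong₂ _+_ (Σ≤-cong n (f≗g ∘ ℕP.m≤n⇒m≤1+n)) (f≗g ℕP.≤-refl)

Σ≤-zero : ∀ n {f : ℕ → ℤ} → (∀ {i} → i ≤ n → f i ≡ 0ℤ) → Σ≤ n f ≡ 0ℤ
Σ≤-zero zero    f≗0 = f≗0 z≤n
Σ≤-zero (suc n) f≗0 = cong₂ _+_ (Σ≤-zero n (f≗0 ∘ ℕP.m≤n⇒m≤1+n)) (f≗0 ℕP.≤-refl)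

Σ≤-suc : ∀ n (f : ℕ → ℤ) → Σ≤ (suc n) f ≡ f 0 + Σ≤ n (f ∘ suc)
Σ≤-suc zero    f = refl
Σ≤-suc (suc n) f = trans (cong (_+ f (suc (suc n))) (Σ≤-suc n f)) (ℤP.+-assoc (f 0) _ _)

Σ≤-+ : ∀ n (f g : ℕ → ℤ) → Σ≤ n (λ i → f i + g i) ≡ Σ≤ n f + Σ≤ n g
Σ≤-+ zero    f g = refl
Σ≤-+ (suc n) f g = trans (cong (_+ (f (suc n) + g (suc n))) (Σ≤-+ n f g))
  (interchange (Σ≤ n f) (Σ≤ n g) (f (suc n)) (g (suc n)))

Σ≤-*ˡ : ∀ n c (f : ℕ → ℤ) → Σ≤ n (λ i → c * f i) ≡ c * Σ≤ n f
Σ≤-*ˡ zero    c f = refl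
Σ≤-*ˡ (suc n) c f = trans (cong (_+ c * f (suc n)) (Σ≤-*ˡ n c f))
  (sym (ℤP.*-distribˡ-+ c (Σ≤ n f) (f (suc n))))

tail : PS → PS
tail F n = F (suc n)

infixr 7 _·ₚ_
_·ₚ_ : ℤ → PS → PS
(c ·ₚ F) n = c * F n

*ₚ-suc : ∀ F G n → (F *ₚ G) (suc n) ≡ F 0 * G (suc n) + (tail F *ₚ G) n
*ₚ-suc F G n = Σ≤-suc n (λ i → F i * G (suc n ∸ i))

*ₚ-sucʳ : ∀ F G n → (F *ₚ G) (suc n) ≡ (F *ₚ tail G) n + F (suc n) * G 0
*ₚ-sucʳ F G n = cong₂ _+_
  (Σ≤-cong n (λ {i} i≤n → cong (λ k → F i * G k) (ℕP.+-∸-assoc 1 i≤n)))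
  (cong (λ k → F (suc n) * G k) (ℕP.n∸n≡0 n))

*ₚ-cong : ∀ {F F′ G G′} → F ≗ F′ → G ≗ G′ → F *ₚ G ≗ F′ *ₚ G′
*ₚ-cong F≗F′ G≗G′ n = Σ≤-cong n (λ _ → cong₂ _*_ (F≗F′ _) (G≗G′ _))

*ₚ-zeroˡ : ∀ F → (λ _ → 0ℤ) *ₚ F ≗ (λ _ → 0ℤ)
*ₚ-zeroˡ F n = Σ≤-zero n (λ _ → refl)

*ₚ-identityˡ : ∀ F → oneₚ *ₚ F ≗ F
*ₚ-identityˡ F zero    = ℤP.*-identityˡ (F 0)
*ₚ-identityˡ F (suc n) = begin
  (oneₚ *ₚ F) (suc n)               ≡⟨ *ₚ-suc oneₚ F n ⟩
  1ℤ * F (suc n) + (tail oneₚ *ₚ F) n ≡⟨ cong₂ _+_ (ℤP.*-identityˡ (F (suc n))) (*ₚ-zeroˡ F n) ⟩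
  F (suc n) + 0ℤ                    ≡⟨ ℤP.+-identityʳ (F (suc n)) ⟩
  F (suc n)                         ∎
  where open ≡-Reasoning

*ₚ-comm : ∀ F G → F *ₚ G ≗ G *ₚ F
*ₚ-comm F G zero    = ℤP.*-comm (F 0) (G 0)
*ₚ-comm F G (suc n) = begin
  (F *ₚ G) (suc n)                    ≡⟨ *ₚ-suc F G n ⟩
  F 0 * G (suc n) + (tail F *ₚ G) n   ≡⟨ cong₂ _+_ (ℤP.*-comm (F 0) (G (suc n))) (*ₚ-comm (tail F) G n) ⟩
  G (suc n) * F 0 + (G *ₚ tail F) n   ≡⟨ ℤP.+-comm (G (suc n) * F 0) _ ⟩
  (G *ₚ tail F) n + G (suc n) * F 0   ≡⟨ *ₚ-sucʳ G F n ⟨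
  (G *ₚ F) (suc n)                    ∎
  where open ≡-Reasoning

*ₚ-distribʳ : ∀ H F G → (F +ₚ G) *ₚ H ≗ F *ₚ H +ₚ G *ₚ H
*ₚ-distribʳ H F G n = trans (Σ≤-cong n (λ _ → ℤP.*-distribʳ-+ (H _) (F _) (G _)))
  (Σ≤-+ n (λ i → F i * H (n ∸ i)) (λ i → G i * H (n ∸ i)))

*ₚ-scaleˡ : ∀ c F G → (c ·ₚ F) *ₚ G ≗ c ·ₚ (F *ₚ G)
*ₚ-scaleˡ c F G n = trans (Σ≤-cong n (λ _ → ℤP.*-assoc c (F _) (G _)))
  (Σ≤-*ˡ n c (λ i → F i * G (n ∸ i)))

*ₚ-assoc : ∀ F G H → (F *ₚ G) *ₚ H ≗ F *ₚ (G *ₚ H)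
*ₚ-assoc F G H zero    = ℤP.*-assoc (F 0) (G 0) (H 0)
*ₚ-assoc F G H (suc n) = begin
  ((F *ₚ G) *ₚ H) (suc n)                                  ≡⟨ *ₚ-suc (F *ₚ G) H n ⟩
  F 0 * G 0 * H (suc n) + (tail (F *ₚ G) *ₚ H) n           ≡⟨ cong (_+_ (F 0 * G 0 * H (suc n))) tail-step ⟩
  F 0 * G 0 * H (suc n) + (F 0 * (tail G *ₚ H) n + (tail F *ₚ (G *ₚ H)) n)
    ≡⟨ regroup (F 0) (G 0) (H (suc n)) ((tail G *ₚ H) n) ((tail F *ₚ (G *ₚ H)) n) ⟩
  F 0 * (G 0 * H (suc n) + (tail G *ₚ H) n) + (tail F *ₚ (G *ₚ H)) n
    ≡⟨ cong (λ x → F 0 * x + (tail F *ₚ (G *ₚ H)) n) (*ₚ-suc G H n) ⟨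
  F 0 * (G *ₚ H) (suc n) + (tail F *ₚ (G *ₚ H)) n           ≡⟨ *ₚ-suc F (G *ₚ H) n ⟨
  (F *ₚ (G *ₚ H)) (suc n)                                  ∎
  where
  open ≡-Reasoning
  tail-step : (tail (F *ₚ G) *ₚ H) n ≡ F 0 * (tail G *ₚ H) n + (tail F *ₚ (G *ₚ H)) n
  tail-step = begin
    (tail (F *ₚ G) *ₚ H) n
      ≡⟨ *ₚ-cong {G = H} (*ₚ-suc F G) (λ _ → refl) n ⟩
    ((F 0 ·ₚ tail G +ₚ tail F *ₚ G) *ₚ H) n
      ≡⟨ *ₚ-distribʳ H (F 0 ·ₚ tail G) (tail F *ₚ G) n ⟩
    ((F 0 ·ₚ tail G) *ₚ H) n + ((tail F *ₚ G) *ₚ H) n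
      ≡⟨ cong₂ _+_ (*ₚ-scaleˡ (F 0) (tail G) H n) (*ₚ-assoc (tail F) G H n) ⟩
    F 0 * (tail G *ₚ H) n + (tail F *ₚ (G *ₚ H)) n     ∎
  regroup : ∀ a b c x y → a * b * c + (a * x + y) ≡ a * (b * c + x) + y
  regroup = solve-∀

+ₚ-*ₚ-commutativeSemiring : CommutativeSemiring 0ℓ 0ℓ
+ₚ-*ₚ-commutativeSemiring = record
  { Carrier               = PS
  ; _≈_                   = _≗_
  ; _+_                   = _+ₚ_
  ; _*_                   = _*ₚ_
  ; 0#                    = λ _ → 0ℤ
  ; 1#                    = oneₚ
  ; isCommutativeSemiring = isCommutativeSemiringˡ record
    { +-isCommutativeMonoid = Pointwise.isCommutativeMonoid ℕ ℤP.+-0-isCommutativeMonoid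
    ; *-isCommutativeMonoid = isCommutativeMonoidˡ record
      { isSemigroup = record
        { isMagma = record { isEquivalence = Pointwise.isEquivalence ℕ isEquivalence ; ∙-cong = *ₚ-cong }
        ; assoc   = *ₚ-assoc
        }
      ; identityˡ = *ₚ-identityˡ
      ; comm      = *ₚ-comm
      }
    ; distribʳ = *ₚ-distribʳ
    ; zeroˡ    = *ₚ-zeroˡ
    }
  }

module Series = CommutativeSemiring +ₚ-*ₚ-commutativeSemiring
open CommutativeSemiringLemmas +ₚ-*ₚ-commutativeSemiring
open import Algebra.Properties.CommutativeSemiring.Exp +ₚ-*ₚ-commutativeSemiring
  using (_^_; ^-distrib-*; ^-assocʳ; ^-congˡ; ^-congʳ)

^ₚ≗^ : ∀ F k → F ^ₚ k ≗ F ^ k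
^ₚ≗^ F zero    = Series.refl
^ₚ≗^ F (suc k) = *ₚ-cong {F} Series.refl (^ₚ≗^ F k)

zₚ-*ₚ-suc : ∀ F n → (zₚ *ₚ F) (suc n) ≡ F n
zₚ-*ₚ-suc F n = begin
  (zₚ *ₚ F) (suc n)               ≡⟨ *ₚ-suc zₚ F n ⟩
  0ℤ + (tail zₚ *ₚ F) n           ≡⟨ ℤP.+-identityˡ _ ⟩
  (tail zₚ *ₚ F) n                ≡⟨ *ₚ-cong {G = F} tail-zₚ Series.refl n ⟩
  (oneₚ *ₚ F) n                   ≡⟨ *ₚ-identityˡ F n ⟩
  F n                             ∎
  where
  open ≡-Reasoning
  tail-zₚ : tail zₚ ≗ oneₚ
  tail-zₚ zero    = refl
  tail-zₚ (suc n) = refl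

zₚ^-*ₚ-+ : ∀ j F m → (zₚ ^ j *ₚ F) (j ℕ.+ m) ≡ F m
zₚ^-*ₚ-+ zero    F m = *ₚ-identityˡ F m
zₚ^-*ₚ-+ (suc j) F m = begin
  (zₚ ^ suc j *ₚ F) (suc j ℕ.+ m)       ≡⟨ Series.*-assoc zₚ (zₚ ^ j) F (suc j ℕ.+ m) ⟩
  (zₚ *ₚ (zₚ ^ j *ₚ F)) (suc (j ℕ.+ m)) ≡⟨ zₚ-*ₚ-suc (zₚ ^ j *ₚ F) (j ℕ.+ m) ⟩
  (zₚ ^ j *ₚ F) (j ℕ.+ m)           ≡⟨ zₚ^-*ₚ-+ j F m ⟩
  F m                              ∎
  where open ≡-Reasoning

zₚ^-*ₚ-< : ∀ j F {n} → n < j → (zₚ ^ j *ₚ F) n ≡ 0ℤ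
zₚ^-*ₚ-< (suc j) F {zero}  _         = Series.*-assoc zₚ (zₚ ^ j) F 0
zₚ^-*ₚ-< (suc j) F {suc n} (s≤s n<j) = begin
  (zₚ ^ suc j *ₚ F) (suc n)     ≡⟨ Series.*-assoc zₚ (zₚ ^ j) F (suc n) ⟩
  (zₚ *ₚ (zₚ ^ j *ₚ F)) (suc n) ≡⟨ zₚ-*ₚ-suc (zₚ ^ j *ₚ F) n ⟩
  (zₚ ^ j *ₚ F) n               ≡⟨ zₚ^-*ₚ-< j F n<j ⟩
  0ℤ                            ∎
  where open ≡-Reasoning

zₚ-*ₚ-tail : ∀ F → F 0 ≡ 0ℤ → F ≗ zₚ *ₚ tail F
zₚ-*ₚ-tail F F₀≡0 zero    = F₀≡0
zₚ-*ₚ-tail F F₀≡0 (suc n) = sym (zₚ-*ₚ-suc (tail F) n)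

^ₚ-vanishes-below : ∀ F k {i} → F 0 ≡ 0ℤ → i < k → (F ^ₚ k) i ≡ 0ℤ
^ₚ-vanishes-below F k {i} F₀≡0 i<k = begin
  (F ^ₚ k) i                    ≡⟨ ^ₚ≗^ F k i ⟩
  (F ^ k) i                     ≡⟨ ^-congˡ k (zₚ-*ₚ-tail F F₀≡0) i ⟩
  ((zₚ *ₚ tail F) ^ k) i        ≡⟨ ^-distrib-* zₚ (tail F) k i ⟩
  (zₚ ^ k *ₚ tail F ^ k) i      ≡⟨ zₚ^-*ₚ-< k (tail F ^ k) i<k ⟩
  0ℤ                            ∎
  where open ≡-Reasoning

module _ (A : PS) (A₀≡1 : A 0 ≡ 1ℤ) where
  private
    B : PS
    B = oneₚ -ₚ A

    B₀≡0 : B 0 ≡ 0ℤ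
    B₀≡0 = cong (_-_ 1ℤ) A₀≡1

    A+B≗1 : A +ₚ B ≗ oneₚ
    A+B≗1 n = a+[b-a]≡b (A n) (oneₚ n)
      where
      a+[b-a]≡b : ∀ a b → a + (b - a) ≡ b
      a+[b-a]≡b = solve-∀

    geometricSum : ℕ → PS
    geometricSum N i = Σ≤ N (λ k → (B ^ₚ k) i)

    geometric-telescope : ∀ N → A *ₚ geometricSum N +ₚ B ^ₚ suc N ≗ oneₚ
    geometric-telescope zero    =
      Series.trans (Series.+-cong (Series.*-identityʳ A) (Series.*-identityʳ B)) A+B≗1
    geometric-telescope (suc N) = begin
      A *ₚ (Sᴺ +ₚ Bᴺ) +ₚ B *ₚ Bᴺ     ≈⟨ Series.+-congʳ {B *ₚ Bᴺ} (Series.distribˡ A Sᴺ Bᴺ) ⟩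
      A *ₚ Sᴺ +ₚ A *ₚ Bᴺ +ₚ B *ₚ Bᴺ   ≈⟨ Series.+-assoc (A *ₚ Sᴺ) (A *ₚ Bᴺ) (B *ₚ Bᴺ) ⟩
      A *ₚ Sᴺ +ₚ (A *ₚ Bᴺ +ₚ B *ₚ Bᴺ) ≈⟨ Series.+-congˡ {A *ₚ Sᴺ} (Series.distribʳ Bᴺ A B) ⟨
      A *ₚ Sᴺ +ₚ (A +ₚ B) *ₚ Bᴺ      ≈⟨ Series.+-congˡ {A *ₚ Sᴺ} (Series.*-congʳ {Bᴺ} A+B≗1) ⟩
      A *ₚ Sᴺ +ₚ oneₚ *ₚ Bᴺ          ≈⟨ Series.+-congˡ {A *ₚ Sᴺ} (Series.*-identityˡ Bᴺ) ⟩
      A *ₚ Sᴺ +ₚ Bᴺ                  ≈⟨ geometric-telescope N ⟩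
      oneₚ                           ∎
      where
      open SetoidReasoning Series.setoid
      Sᴺ Bᴺ : PS
      Sᴺ = geometricSum N
      Bᴺ = B ^ₚ suc N

    geometricSum-+ : ∀ d j → geometricSum (d ℕ.+ j) j ≡ inv A j
    geometricSum-+ zero    j = refl
    geometricSum-+ (suc d) j = trans
      (cong₂ _+_ (geometricSum-+ d j) (^ₚ-vanishes-below B (suc (d ℕ.+ j)) B₀≡0 (s≤s (ℕP.m≤n+m j d))))
      (ℤP.+-identityʳ _)

    geometricSum-stable : ∀ {j N} → j ≤ N → geometricSum N j ≡ inv A j
    geometricSum-stable {j} {N} j≤N =
      trans (cong (λ N → geometricSum N j) (sym (ℕP.m∸n+n≡m j≤N))) (geometricSum-+ (N ∸ j) j)

  *ₚ-inv : A *ₚ inv A ≗ oneₚ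
  *ₚ-inv n = begin
    (A *ₚ inv A) n                                 ≡⟨ Σ≤-cong n geometricSum≡inv ⟨
    (A *ₚ geometricSum n) n                        ≡⟨ ℤP.+-identityʳ _ ⟨
    (A *ₚ geometricSum n) n + 0ℤ
      ≡⟨ cong (_+_ ((A *ₚ geometricSum n) n)) (^ₚ-vanishes-below B (suc n) B₀≡0 (ℕP.n<1+n n)) ⟨
    (A *ₚ geometricSum n) n + (B ^ₚ suc n) n       ≡⟨ geometric-telescope n n ⟩
    oneₚ n                                         ∎
    where
    open ≡-Reasoning
    geometricSum≡inv : ∀ {i} → i ≤ n → A i * geometricSum n (n ∸ i) ≡ A i * inv A (n ∸ i)
    geometricSum≡inv {i} _ = cong (A i *_) (geometricSum-stable (ℕP.m∸n≤m n i))

ΔC : ℕ → ℕ → ℤ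
ΔC a j = + (a C suc j) - + (a C j)

ΔC-pascal : ∀ a j → ΔC (suc a) (suc j) ≡ ΔC a (suc j) + ΔC a j
ΔC-pascal a j = begin
  + (suc a C suc (suc j)) - + (suc a C suc j)
    ≡⟨ cong₂ (λ x y → + x - + y) (nCk+nC[k+1]≡[n+1]C[k+1] a (suc j)) (nCk+nC[k+1]≡[n+1]C[k+1] a j) ⟨
  + (a C suc j ℕ.+ a C suc (suc j)) - + (a C j ℕ.+ a C suc j)
    ≡⟨ cong₂ _-_ (ℤP.pos-+ (a C suc j) _) (ℤP.pos-+ (a C j) _) ⟩
  (+ (a C suc j) + + (a C suc (suc j))) - (+ (a C j) + + (a C suc j))
    ≡⟨ regroup (+ (a C j)) (+ (a C suc j)) (+ (a C suc (suc j))) ⟩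
  ΔC a (suc j) + ΔC a j ∎
  where
  open ≡-Reasoning
  regroup : ∀ x y z → (y + z) - (x + y) ≡ (z - y) + (y - x)
  regroup = solve-∀

ΔC-pascal-zero : ∀ a → ΔC (suc a) 0 ≡ ΔC a 0 + 1ℤ
ΔC-pascal-zero a = begin
  + (suc a C 1) - 1ℤ           ≡⟨ cong (λ x → + x - 1ℤ) (nCk+nC[k+1]≡[n+1]C[k+1] a 0) ⟨
  + (1 ℕ.+ a C 1) - 1ℤ         ≡⟨ cong (_- 1ℤ) (ℤP.pos-+ 1 (a C 1)) ⟩
  (1ℤ + + (a C 1)) - 1ℤ        ≡⟨ regroup (+ (a C 1)) ⟩
  (+ (a C 1) - 1ℤ) + 1ℤ        ∎
  where
  open ≡-Reasoning
  regroup : ∀ x → (1ℤ + x) - 1ℤ ≡ (x - 1ℤ) + 1ℤ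
  regroup = solve-∀

ΔC-central : ∀ j → ΔC (suc (j ℕ.+ j)) j ≡ 0ℤ
ΔC-central j = begin
  + (a C suc j) - + (a C j)         ≡⟨ cong (λ x → + (a C suc j) - + x) (nCk≡nC[n∸k] (ℕP.m≤n+m j (suc j))) ⟩
  + (a C suc j) - + (a C (a ∸ j))   ≡⟨ cong (λ k → + (a C suc j) - + (a C k)) (ℕP.m+n∸n≡m (suc j) j) ⟩
  + (a C suc j) - + (a C suc j)     ≡⟨ ℤP.+-inverseʳ (+ (a C suc j)) ⟩
  0ℤ                                ∎
  where
  open ≡-Reasoning
  a : ℕ
  a = suc j ℕ.+ j

-- ballot k m = binom(2m+k-1, m) - binom(2m+k-1, m-1), the coefficient of z^m in C^k for C = 1 + zC².
ballot : ℕ → ℕ → ℤ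
ballot k zero    = 1ℤ
ballot k (suc j) = ΔC (k ℕ.+ suc (j ℕ.+ j)) j

ballot-suc-suc : ∀ k m → ballot (suc k) (suc m) ≡ ballot k (suc m) + ballot (2 ℕ.+ k) m
ballot-suc-suc k zero    = ΔC-pascal-zero (k ℕ.+ 1)
ballot-suc-suc k (suc j) = trans (ΔC-pascal (k ℕ.+ suc (suc j ℕ.+ suc j)) j)
  (cong (λ a → ΔC (k ℕ.+ suc (suc j ℕ.+ suc j)) (suc j) + ΔC a j) (index k j))
  where
  index : ∀ k j → k ℕ.+ suc (suc (j ℕ.+ suc j)) ≡ suc (suc (k ℕ.+ suc (j ℕ.+ j)))
  index = ℕSolver.solve-∀

ballot-unique : (P : ℕ → ℕ → ℤ) →
                (∀ k → P k 0 ≡ 1ℤ) →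
                (∀ j → P 0 (suc j) ≡ 0ℤ) →
                (∀ k m → P (suc k) (suc m) ≡ P k (suc m) + P (2 ℕ.+ k) m) →
                ∀ k m → P k m ≡ ballot k m
ballot-unique P P-0 P-zero-suc P-suc-suc = go
  where
  go : ∀ k m → P k m ≡ ballot k m
  go k       zero    = P-0 k
  go zero    (suc j) = trans (P-zero-suc j) (sym (ΔC-central j))
  go (suc k) (suc m) = begin
    P (suc k) (suc m)                        ≡⟨ P-suc-suc k m ⟩
    P k (suc m) + P (2 ℕ.+ k) m              ≡⟨ cong₂ _+_ (go k (suc m)) (go (2 ℕ.+ k) m) ⟩
    ballot k (suc m) + ballot (2 ℕ.+ k) m    ≡⟨ ballot-suc-suc k m ⟨
    ballot (suc k) (suc m)                   ∎
    where open ≡-Reasoning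

[+m]-[+n]≡+[m∸n] : ∀ {m n} → n ≤ m → + m - + n ≡ + (m ∸ n)
[+m]-[+n]≡+[m∸n] {m} {n} n≤m = trans (ℤP.[+m]-[+n]≡m⊖n m n) (ℤP.⊖-≥ n≤m)

falling-pos : ∀ {a} j → j ≤ a → falling (+ a) j ≡ + (a P′ j)
falling-pos     zero    _   = refl
falling-pos {a} (suc j) j<a = begin
  falling (+ a) j * (+ a - + j)  ≡⟨ cong₂ _*_ (falling-pos j j≤a) ([+m]-[+n]≡+[m∸n] j≤a) ⟩
  + (a P′ j) * + (a ∸ j)         ≡⟨ ℤP.pos-* (a P′ j) (a ∸ j) ⟨
  + ((a P′ j) ℕ.* (a ∸ j))       ≡⟨ cong +_ (ℕP.*-comm (a P′ j) (a ∸ j)) ⟩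
  + (a P′ suc j)                 ∎
  where
  open ≡-Reasoning
  j≤a : j ≤ a
  j≤a = ℕP.<⇒≤ j<a

binom-pos : ∀ {a j} → j ≤ a → binom (+ a) (+ j) ≡ + (a C j)
binom-pos {a} {j} j≤a = begin
  binom (+ a) (+ j)             ≡⟨ cong (λ x → (x /ℕ j !) {{j !≢0}}) (falling-pos j j≤a) ⟩
  + (((a P′ j) ℕ./ j !) {{j !≢0}}) ≡⟨ cong (λ x → + (x ℕ./ j !) {{j !≢0}}) P≡P′ ⟨
  + (((a P j) ℕ./ j !) {{j !≢0}}) ≡⟨ cong +_ (nCk≡nPk/k! j≤a) ⟨
  + (a C j)                     ∎
  where
  open ≡-Reasoning
  P≡P′ : a P j ≡ a P′ j
  P≡P′ = trans (nPk≡n!/[n∸k]! j≤a) (sym (nP′k≡n!/[n∸k]! j≤a))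

ballot-binom : ∀ k m →
               ballot (suc k) m ≡ binom (+ (2 ℕ.* m ℕ.+ k)) (+ m) - binom (+ (2 ℕ.* m ℕ.+ k)) (+ m - + 1)
ballot-binom k zero    = refl
ballot-binom k (suc j) = begin
  ΔC (suc k ℕ.+ suc (j ℕ.+ j)) j             ≡⟨ cong (λ a → ΔC a j) (index k j) ⟩
  ΔC a j                                     ≡⟨ cong₂ _-_ (binom-pos 1+j≤a) (binom-pos (ℕP.<⇒≤ 1+j≤a)) ⟨
  binom (+ a) (+ suc j) - binom (+ a) (+ j)  ∎
  where
  open ≡-Reasoning
  a : ℕ
  a = 2 ℕ.* suc j ℕ.+ k
  index : ∀ k j → suc k ℕ.+ suc (j ℕ.+ j) ≡ 2 ℕ.* suc j ℕ.+ k
  index = ℕSolver.solve-∀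
  1+j≤a : suc j ≤ a
  1+j≤a = ℕP.≤-trans (ℕP.m≤n*m (suc j) 2) (ℕP.m≤m+n _ k)

binom-⊖-< : ∀ a {m n} → m < n → binom a (m ⊖ n) ≡ 0ℤ
binom-⊖-< a {m} {n} m<n rewrite ℤP.⊖-< m<n with n ∸ m | ℕP.m<n⇒0<n∸m m<n
... | suc _ | _ = refl

[+m]-[+n]-[+o]≡m⊖[n+o] : ∀ m n o → + m - + n - + o ≡ m ⊖ (n ℕ.+ o)
[+m]-[+n]-[+o]≡m⊖[n+o] m n o = begin
  + m - + n - + o        ≡⟨ ℤP.+-assoc (+ m) (- + n) (- + o) ⟩
  + m + (- + n - + o)    ≡⟨ cong (_+_ (+ m)) (ℤP.neg-distrib-+ (+ n) (+ o)) ⟨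
  + m - (+ n + + o)      ≡⟨ cong (λ x → + m - x) (ℤP.pos-+ n o) ⟨
  + m - + (n ℕ.+ o)      ≡⟨ ℤP.[+m]-[+n]≡m⊖n m (n ℕ.+ o) ⟩
  m ⊖ (n ℕ.+ o)          ∎
  where open ≡-Reasoning

shiftedBallot : ℕ → ℕ → ℤ
shiftedBallot t n = binom a (+ n - + t - + 2) - binom a (+ n - + t - + 3)
  where
  a : ℤ
  a = + (2 ℕ.* n) - + 3

shiftedBallot-< : ∀ {t n} → n < t ℕ.+ 2 → shiftedBallot t n ≡ 0ℤ
shiftedBallot-< {t} {n} n<t+2 = begin
  binom a (+ n - + t - + 2) - binom a (+ n - + t - + 3)
    ≡⟨ cong₂ (λ i j → binom a i - binom a j)
             ([+m]-[+n]-[+o]≡m⊖[n+o] n t 2) ([+m]-[+n]-[+o]≡m⊖[n+o] n t 3) ⟩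
  binom a (n ⊖ (t ℕ.+ 2)) - binom a (n ⊖ (t ℕ.+ 3))
    ≡⟨ cong₂ _-_ (binom-⊖-< a n<t+2) (binom-⊖-< a n<t+3) ⟩
  0ℤ ∎
  where
  open ≡-Reasoning
  a : ℤ
  a = + (2 ℕ.* n) - + 3
  n<t+3 : n < t ℕ.+ 3
  n<t+3 = ℕP.<-≤-trans n<t+2 (ℕP.+-monoʳ-≤ t (ℕP.n≤1+n 2))

shiftedBallot-+ : ∀ t m → shiftedBallot t (t ℕ.+ 2 ℕ.+ m) ≡ ballot (2 ℕ.* suc t) m
shiftedBallot-+ t m = begin
  binom (+ (2 ℕ.* n) - + 3) (+ n - + t - + 2) - binom (+ (2 ℕ.* n) - + 3) (+ n - + t - + 3)
    ≡⟨ cong (λ a → binom a (+ n - + t - + 2) - binom a (+ n - + t - + 3)) upper ⟩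
  binom a (+ n - + t - + 2) - binom a (+ n - + t - + 3)
    ≡⟨ cong₂ (λ i j → binom a i - binom a j) lower₂ lower₃ ⟩
  binom a (+ m) - binom a (+ m - + 1)
    ≡⟨ ballot-binom (t ℕ.+ suc (t ℕ.+ 0)) m ⟨
  ballot (2 ℕ.* suc t) m ∎
  where
  open ≡-Reasoning
  n : ℕ
  n = t ℕ.+ 2 ℕ.+ m
  a : ℤ
  a = + (2 ℕ.* m ℕ.+ (t ℕ.+ suc (t ℕ.+ 0)))
  index : ∀ t m → 2 ℕ.* (t ℕ.+ 2 ℕ.+ m) ≡ 3 ℕ.+ (2 ℕ.* m ℕ.+ (t ℕ.+ suc (t ℕ.+ 0)))
  index = ℕSolver.solve-∀
  upper : + (2 ℕ.* n) - + 3 ≡ a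
  upper = cong (λ x → + x - + 3) (index t m)
  lower₂ : + n - + t - + 2 ≡ + m
  lower₂ = begin
    + n - + t - + 2       ≡⟨ [+m]-[+n]-[+o]≡m⊖[n+o] n t 2 ⟩
    n ⊖ (t ℕ.+ 2)         ≡⟨ ℤP.⊖-≥ (ℕP.m≤m+n (t ℕ.+ 2) m) ⟩
    + (n ∸ (t ℕ.+ 2))     ≡⟨ cong +_ (ℕP.m+n∸m≡n (t ℕ.+ 2) m) ⟩
    + m                   ∎
  lower₃ : + n - + t - + 3 ≡ + m - + 1
  lower₃ = begin
    + n - + t - + 3       ≡⟨ [+m]-[+n]-[+o]≡m⊖[n+o] n t 3 ⟩
    n ⊖ (t ℕ.+ 3)         ≡⟨ cong (n ⊖_) (ℕP.+-assoc t 2 1) ⟨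
    n ⊖ (t ℕ.+ 2 ℕ.+ 1)   ≡⟨ ℤP.+-cancelˡ-⊖ (t ℕ.+ 2) m 1 ⟩
    m ⊖ 1                 ∎

zₚ^[t+2]-*ₚ-ballot : ∀ t n F → (∀ m → F m ≡ ballot (2 ℕ.* suc t) m) →
                     (zₚ ^ (t ℕ.+ 2) *ₚ F) n ≡ shiftedBallot t n
zₚ^[t+2]-*ₚ-ballot t n F F≡ballot with ℕP.<-≤-connex n (t ℕ.+ 2)
... | inj₁ n<t+2 = trans (zₚ^-*ₚ-< (t ℕ.+ 2) F n<t+2) (sym (shiftedBallot-< n<t+2))
... | inj₂ t+2≤n with ℕP.m≤n⇒∃[o]m+o≡n t+2≤n
... | m , refl = begin
  (zₚ ^ (t ℕ.+ 2) *ₚ F) (t ℕ.+ 2 ℕ.+ m)   ≡⟨ zₚ^-*ₚ-+ (t ℕ.+ 2) F m ⟩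
  F m                                   ≡⟨ F≡ballot m ⟩
  ballot (2 ℕ.* suc t) m                ≡⟨ shiftedBallot-+ t m ⟨
  shiftedBallot t (t ℕ.+ 2 ℕ.+ m)         ∎
  where open ≡-Reasoning

module CatalanSeries (M : PS)
                     (M-eq : M ≗ oneₚ +ₚ const (+ 2) *ₚ zₚ *ₚ M +ₚ (zₚ ^ₚ 2) *ₚ (M ^ₚ 2)) where

  Cat : PS
  Cat = oneₚ +ₚ zₚ *ₚ M

  M≗Cat² : M ≗ Cat ^ 2
  M≗Cat² = begin
    M                                                      ≈⟨ M-eq ⟩
    oneₚ +ₚ const (+ 2) *ₚ zₚ *ₚ M +ₚ (zₚ ^ₚ 2) *ₚ (M ^ₚ 2)
      ≈⟨ Series.+-cong (Series.+-congˡ {oneₚ} (Series.*-congʳ {M} (Series.*-congʳ {zₚ} 2≗1+1)))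
                       (Series.*-cong (^ₚ≗^ zₚ 2) (^ₚ≗^ M 2)) ⟩
    oneₚ +ₚ (oneₚ +ₚ oneₚ) *ₚ zₚ *ₚ M +ₚ zₚ ^ 2 *ₚ M ^ 2     ≈⟨ square zₚ M ⟩
    Cat ^ 2                                                  ∎
    where
    open SetoidReasoning Series.setoid
    open SemiringSolver +ₚ-*ₚ-commutativeSemiring
    2≗1+1 : const (+ 2) ≗ oneₚ +ₚ oneₚ
    2≗1+1 zero    = refl
    2≗1+1 (suc n) = refl
    square : ∀ z m → oneₚ +ₚ (oneₚ +ₚ oneₚ) *ₚ z *ₚ m +ₚ z ^ 2 *ₚ m ^ 2 ≗ (oneₚ +ₚ z *ₚ m) ^ 2
    square = solve 2 (λ z m → con 1 :+ con 2 :* z :* m :+ z :^ 2 :* m :^ 2 := (con 1 :+ z :* m) :^ 2) Series.refl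

  Cat^-zero : ∀ k → (Cat ^ k) 0 ≡ 1ℤ
  Cat^-zero zero    = refl
  Cat^-zero (suc k) = cong (1ℤ *_) (Cat^-zero k)

  Cat^-suc-suc : ∀ k m → (Cat ^ suc k) (suc m) ≡ (Cat ^ k) (suc m) + (Cat ^ (2 ℕ.+ k)) m
  Cat^-suc-suc k m = trans (c≈1+zc²⇒c^[1+k]≈c^k+z*c^[2+k] {Cat} {zₚ} k Cat≗1+zCat² (suc m))
                         (cong (_+_ ((Cat ^ k) (suc m))) (zₚ-*ₚ-suc (Cat ^ (2 ℕ.+ k)) m))
    where
    Cat≗1+zCat² : Cat ≗ oneₚ +ₚ zₚ *ₚ Cat ^ 2
    Cat≗1+zCat² = Series.+-congˡ {oneₚ} (Series.*-congˡ {zₚ} M≗Cat²)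

  Cat^≡ballot : ∀ k m → (Cat ^ k) m ≡ ballot k m
  Cat^≡ballot = ballot-unique (λ k → Cat ^ k) Cat^-zero (λ _ → refl) Cat^-suc-suc

  [zM]^[t+2]/Cat²≗z^[t+2]*Cat^[2t+2] :
    ∀ t → (zₚ *ₚ M) ^ₚ (t ℕ.+ 2) *ₚ inv (Cat ^ₚ 2) ≗ zₚ ^ (t ℕ.+ 2) *ₚ Cat ^ (2 ℕ.* suc t)
  [zM]^[t+2]/Cat²≗z^[t+2]*Cat^[2t+2] t = begin
    (zₚ *ₚ M) ^ₚ (t ℕ.+ 2) *ₚ W     ≈⟨ Series.*-congʳ {W} (^ₚ≗^ (zₚ *ₚ M) (t ℕ.+ 2)) ⟩
    (zₚ *ₚ M) ^ (t ℕ.+ 2) *ₚ W      ≈⟨ Series.*-congʳ {W} (^-congʳ (zₚ *ₚ M) (ℕP.+-comm t 2)) ⟩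
    (zₚ *ₚ M) ^ suc (suc t) *ₚ W    ≈⟨ m*w≈1⇒[z*m]^[1+j]*w≈z^[1+j]*m^j {M} {W} zₚ (suc t) M*W≗1 ⟩
    zₚ ^ suc (suc t) *ₚ M ^ suc t   ≈⟨ Series.*-cong (^-congʳ zₚ (ℕP.+-comm 2 t)) (^-congˡ (suc t) M≗Cat²) ⟩
    zₚ ^ (t ℕ.+ 2) *ₚ (Cat ^ 2) ^ suc t ≈⟨ Series.*-congˡ {zₚ ^ (t ℕ.+ 2)} (^-assocʳ Cat 2 (suc t)) ⟩
    zₚ ^ (t ℕ.+ 2) *ₚ Cat ^ (2 ℕ.* suc t) ∎
    where
    open SetoidReasoning Series.setoid
    W : PS
    W = inv (Cat ^ₚ 2)
    M*W≗1 : M *ₚ W ≗ oneₚ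
    M*W≗1 = Series.trans (Series.*-congʳ {W} (Series.trans M≗Cat² (Series.sym (^ₚ≗^ Cat 2))))
                         (*ₚ-inv (Cat ^ₚ 2) refl)

lemma15 : (M : PS)
    → (∀ m → M m ≡ (oneₚ +ₚ const (+ 2) *ₚ zₚ *ₚ M +ₚ (zₚ ^ₚ 2) *ₚ (M ^ₚ 2)) m)
    → (t n : ℕ) → 1 ≤ n
    → coeff n ((zₚ *ₚ M) ^ₚ (t Data.Nat.+ 2) *ₚ inv ((oneₚ +ₚ zₚ *ₚ M) ^ₚ 2))
      ≡ binom (+ (2 Data.Nat.* n) - + 3) (+ n - + t - + 2)
        - binom (+ (2 Data.Nat.* n) - + 3) (+ n - + t - + 3)
lemma15 M M-eq t n _ = trans ([zM]^[t+2]/Cat²≗z^[t+2]*Cat^[2t+2] t n)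
  (zₚ^[t+2]-*ₚ-ballot t n (Cat ^ (2 ℕ.* suc t)) (Cat^≡ballot (2 ℕ.* suc t)))
  where open CatalanSeries M M-eq
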